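{- Let $q$ be a prime power and let $r$ be a prime dividing $q-1$. Then for every positive integer $d$ and every integer $1\le k\le r^d-1$, there exists a polynomial $f\in\mathbb{F}_q[x]$ of degree $k$ that divides $x^{r^d}-1$ and satisfies $f(1)\ne0$. -}

module Defs where

open import Level using (Level; _⊔_; suc)
open import Data.Nat as ℕ using (ℕ; zero; suc; _^_; _∸_; _<_; _≤_)
open import Data.Nat.Primality using (Prime)
open import Data.Fin using (Fin)
open import Data.List using (List; []; _∷_; map; foldr; replicate; _++_)
open import Data.Product using (Σ; ∃; _×_; _,_)
open import Relation.Binary.PropositionalEquality using (_≡_)
open import Relation.Nullary using (¬_)
open import Algebra.Bundles using (CommutativeRing)

IsPrimePower : ℕ → Set
IsPrimePower q = Σ ℕ λ p → Σ ℕ λ e → Prime p × 1 ≤ e × q ≡ p ^ e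

record Field (c ℓ : Level) : Set (Level.suc (c ⊔ ℓ)) where
  field
    commutativeRing : CommutativeRing c ℓ
  open CommutativeRing commutativeRing public
  field
    0≉1     : ¬ (0# ≈ 1#)
    inverse : ∀ x → ¬ (x ≈ 0#) → ∃ λ y → x * y ≈ 1#

record HasCardinality {c ℓ} (F : Field c ℓ) (q : ℕ) : Set (c ⊔ ℓ) where
  open Field F
  field
    enum      : Fin q → Carrier
    injective : ∀ i j → enum i ≈ enum j → i ≡ j
    surjective : ∀ x → ∃ λ i → enum i ≈ x

-- Univariate polynomials over a field, as coefficient lists
-- (lowest degree first); trailing zero coefficients are allowed and
-- all notions below are invariant under them.
module Poly {c ℓ} (F : Field c ℓ) where
  open Field F

  Pol : Set c
  Pol = List Carrier

  coeff : Pol → ℕ → Carrier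
  coeff []      _       = 0#
  coeff (a ∷ f) zero    = a
  coeff (a ∷ f) (suc i) = coeff f i

  _≈ₚ_ : Pol → Pol → Set ℓ
  f ≈ₚ g = ∀ i → coeff f i ≈ coeff g i

  _+ₚ_ : Pol → Pol → Pol
  []      +ₚ g       = g
  (a ∷ f) +ₚ []      = a ∷ f
  (a ∷ f) +ₚ (b ∷ g) = (a + b) ∷ (f +ₚ g)

  _*ₚ_ : Pol → Pol → Pol
  []      *ₚ g = []
  (a ∷ f) *ₚ g = map (a *_) g +ₚ (0# ∷ (f *ₚ g))

  xⁿ-1 : ℕ → Pol
  xⁿ-1 n = (replicate n 0# ++ (1# ∷ [])) +ₚ ((- 1#) ∷ [])

  HasDegree : Pol → ℕ → Set ℓ
  HasDegree f k = ¬ (coeff f k ≈ 0#) × (∀ i → k < i → coeff f i ≈ 0#)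

  _∣ₚ_ : Pol → Pol → Set (c ⊔ ℓ)
  f ∣ₚ g = ∃ λ h → (f *ₚ h) ≈ₚ g

  eval : Pol → Carrier → Carrier
  eval f a = foldr (λ b acc → b + a * acc) 0# f

-- Since r ∣ q − 1, F contains a primitive r-th root of unity ζ: with q − 1 = M r, some nonzero x has
-- x ^ M ≠ 1 (x ^ M − 1 has at most M < q − 1 roots), and ζ = x ^ M has ζ ^ r = x ^ (q − 1) = 1 by Fermat.
-- Divisors of x ^ (r ^ j) − 1 that do not vanish at 1 are then built by induction on j. If f ∣ x ^ N − 1 and
-- f(1) ≠ 0, then f(x ^ r) ∣ x ^ (r N) − 1, and f(x ^ r) takes the value f(1) ≠ 0 at every power of ζ. Since
-- every ζ ^ u is a root of x ^ (r N) − 1, the distinct roots ζ, …, ζ ^ a (a < r) all divide the cofactor, so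
-- f(x ^ r) (x − ζ) ⋯ (x − ζ ^ a) is a divisor of degree r deg f + a, still nonzero at 1. Writing k in base r
-- reaches every degree k < r ^ d.

module Submission where

open import Defs
open import Level using (Level)
open import Data.Nat as ℕ using (ℕ; zero; suc; _∸_; _≤_; _<_; z≤n; s≤s)
import Data.Nat.Properties as ℕ
open import Data.Nat.Divisibility using (_∣_)
open import Data.Nat.Primality using (Prime)
open import Data.Product using (∃; _×_; _,_; proj₁; proj₂)
open import Data.Empty using (⊥-elim)
open import Function using (_∘_)
open import Relation.Nullary using (¬_)
import Relation.Binary.PropositionalEquality as ≡
open ≡ using (_≡_)

module FieldProperties {c ℓ} (F : Field c ℓ) where
  open Field F hiding (zero)
  open import Relation.Binary.Reasoning.Setoid setoid
  open import Algebra.Properties.Semiring.Exp semiring public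
    using (_^_; ^-congˡ; ^-homo-*; ^-assocʳ)
  open import Algebra.Properties.Group +-group public
    using (x∙y⁻¹≈ε⇒x≈y; x≈y⇒x∙y⁻¹≈ε)
  open import Algebra.Properties.Group +-group using (\\-leftDividesʳ)
  open import Algebra.Properties.Ring ring using (-‿distribˡ-*)
  open import Data.Nat.Coprimality using (prime⇒coprime; coprime-Bézout)
  open import Data.Nat.GCD using (module Bézout)

  *-cancelˡ-≉0 : ∀ {x y z} → ¬ x ≈ 0# → x * y ≈ x * z → y ≈ z
  *-cancelˡ-≉0 {x} {y} {z} x≉0 xy≈xz with inverse x x≉0
  ... | x⁻¹ , xx⁻¹≈1 = begin
    y              ≈⟨ *-identityˡ y ⟨
    1# * y         ≈⟨ *-congʳ (trans (sym xx⁻¹≈1) (*-comm x x⁻¹)) ⟩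
    (x⁻¹ * x) * y  ≈⟨ *-assoc x⁻¹ x y ⟩
    x⁻¹ * (x * y)  ≈⟨ *-congˡ xy≈xz ⟩
    x⁻¹ * (x * z)  ≈⟨ *-assoc x⁻¹ x z ⟨
    (x⁻¹ * x) * z  ≈⟨ *-congʳ (trans (*-comm x⁻¹ x) xx⁻¹≈1) ⟩
    1# * z         ≈⟨ *-identityˡ z ⟩
    z              ∎

  *-cancelʳ-≉0 : ∀ {x y z} → ¬ z ≈ 0# → x * z ≈ y * z → x ≈ y
  *-cancelʳ-≉0 {x} {y} {z} z≉0 xz≈yz =
    *-cancelˡ-≉0 z≉0 (trans (*-comm z x) (trans xz≈yz (*-comm y z)))

  x≉0∧xy≈0⇒y≈0 : ∀ {x y} → ¬ x ≈ 0# → x * y ≈ 0# → y ≈ 0#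
  x≉0∧xy≈0⇒y≈0 {x} x≉0 xy≈0 = *-cancelˡ-≉0 x≉0 (trans xy≈0 (sym (zeroʳ x)))

  *-≉0 : ∀ {x y} → ¬ x ≈ 0# → ¬ y ≈ 0# → ¬ x * y ≈ 0#
  *-≉0 x≉0 y≉0 xy≈0 = y≉0 (x≉0∧xy≈0⇒y≈0 x≉0 xy≈0)

  -[x*y]+[z+x*y]≈z : ∀ x y z → - x * y + (z + x * y) ≈ z
  -[x*y]+[z+x*y]≈z x y z = begin
    - x * y + (z + x * y)    ≈⟨ +-cong (-‿distribˡ-* x y) (+-comm (x * y) z) ⟨
    - (x * y) + (x * y + z)  ≈⟨ \\-leftDividesʳ (x * y) z ⟩
    z                        ∎

  ^-≉0 : ∀ {x} n → ¬ x ≈ 0# → ¬ x ^ n ≈ 0#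
  ^-≉0 zero    x≉0 1≈0 = 0≉1 (sym 1≈0)
  ^-≉0 (suc n) x≉0     = *-≉0 x≉0 (^-≉0 n x≉0)

  1^n≈1 : ∀ n → 1# ^ n ≈ 1#
  1^n≈1 zero    = refl
  1^n≈1 (suc n) = trans (*-identityˡ _) (1^n≈1 n)

  ^-multiple-≈1 : ∀ {x} m → x ^ m ≈ 1# → ∀ n → x ^ (n ℕ.* m) ≈ 1#
  ^-multiple-≈1 {x} m xᵐ≈1 n = begin
    x ^ (n ℕ.* m)  ≡⟨ ≡.cong (x ^_) (ℕ.*-comm n m) ⟩
    x ^ (m ℕ.* n)  ≈⟨ ^-assocʳ x m n ⟨
    (x ^ m) ^ n    ≈⟨ ^-congˡ n xᵐ≈1 ⟩
    1# ^ n         ≈⟨ 1^n≈1 n ⟩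
    1#             ∎

  IsPrimitiveRoot : Carrier → ℕ → Set ℓ
  IsPrimitiveRoot ζ n = ζ ^ n ≈ 1# × (∀ w → 0 < w → w < n → ¬ ζ ^ w ≈ 1#)

  prime-order⇒primitive : ∀ {ζ r} → Prime r → ζ ^ r ≈ 1# → ¬ ζ ≈ 1# → IsPrimitiveRoot ζ r
  prime-order⇒primitive {ζ} {r} r-prime ζʳ≈1 ζ≉1 = ζʳ≈1 , no-smaller-order
    where
    ζ≈1 : ∀ m n → 1 ℕ.+ m ≡ n → ζ ^ m ≈ 1# → ζ ^ n ≈ 1# → ζ ≈ 1#
    ζ≈1 m n 1+m≡n ζᵐ≈1 ζⁿ≈1 = begin
      ζ              ≈⟨ *-identityʳ ζ ⟨
      ζ * 1#         ≈⟨ *-congˡ ζᵐ≈1 ⟨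
      ζ ^ (1 ℕ.+ m)  ≡⟨ ≡.cong (ζ ^_) 1+m≡n ⟩
      ζ ^ n          ≈⟨ ζⁿ≈1 ⟩
      1#             ∎

    -- Bézout for the coprime pair (r, w) writes 1 + (a multiple of one) as a multiple of the other.
    no-smaller-order : ∀ w → 0 < w → w < r → ¬ ζ ^ w ≈ 1#
    no-smaller-order w@(suc _) _ w<r ζʷ≈1 with coprime-Bézout (prime⇒coprime r-prime w<r)
    ... | Bézout.+- a b eq = ζ≉1 (ζ≈1 _ _ eq (^-multiple-≈1 w ζʷ≈1 b) (^-multiple-≈1 r ζʳ≈1 a))
    ... | Bézout.-+ a b eq = ζ≉1 (ζ≈1 _ _ eq (^-multiple-≈1 r ζʳ≈1 a) (^-multiple-≈1 w ζʷ≈1 b))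

  root-of-unity-≉0 : ∀ {ζ} n → ζ ^ suc n ≈ 1# → ¬ ζ ≈ 0#
  root-of-unity-≉0 {ζ} n ζⁿ≈1 ζ≈0 = 0≉1 (begin
    0#              ≈⟨ zeroˡ (ζ ^ n) ⟨
    0# * ζ ^ n      ≈⟨ *-congʳ ζ≈0 ⟨
    ζ ^ suc n       ≈⟨ ζⁿ≈1 ⟩
    1#              ∎)

  primitive-^-distinct : ∀ {ζ n u v} → IsPrimitiveRoot ζ n → u < v → v < n → ¬ ζ ^ u ≈ ζ ^ v
  primitive-^-distinct {ζ} {suc n} {u} {v} (ζⁿ≈1 , minimal) u<v v<n ζᵘ≈ζᵛ =
    minimal (v ∸ u) (ℕ.m<n⇒0<n∸m u<v) (ℕ.≤-<-trans (ℕ.m∸n≤m v u) v<n)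
      (sym (*-cancelʳ-≉0 (^-≉0 u (root-of-unity-≉0 n ζⁿ≈1)) (begin
        1# * ζ ^ u           ≈⟨ *-identityˡ _ ⟩
        ζ ^ u                ≈⟨ ζᵘ≈ζᵛ ⟩
        ζ ^ v                ≡⟨ ≡.cong (ζ ^_) (ℕ.m∸n+n≡m (ℕ.<⇒≤ u<v)) ⟨
        ζ ^ (v ∸ u ℕ.+ u)    ≈⟨ ^-homo-* ζ (v ∸ u) u ⟩
        ζ ^ (v ∸ u) * ζ ^ u  ∎)))

module PolynomialArithmetic {c ℓ} (F : Field c ℓ) where
  open Field F hiding (zero)
  open Poly F
  open import Data.List using ([]; _∷_; map; replicate; _++_)
  open import Relation.Binary.Bundles using (Setoid)
  import Relation.Binary.Reasoning.Setoid as SetoidReasoning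
  open SetoidReasoning setoid
  open import Algebra.Solver.Ring.NaturalCoefficients.Default commutativeSemiring
    using (solve; _:+_; _:*_; _:=_)

  -- _≈ₚ_ wrapped in a record, so that both polynomials can be inferred from a proof.
  infix 4 _≋_
  record _≋_ (f g : Pol) : Set ℓ where
    constructor coeffwise
    field coeff-≈ : f ≈ₚ g
  open _≋_ public

  ≋-setoid : Setoid c ℓ
  ≋-setoid = record
    { Carrier       = Pol
    ; _≈_           = _≋_
    ; isEquivalence = record
      { refl  = coeffwise λ _ → refl
      ; sym   = λ (coeffwise f≈g) → coeffwise λ i → sym (f≈g i)
      ; trans = λ (coeffwise f≈g) (coeffwise g≈h) → coeffwise λ i → trans (f≈g i) (g≈h i)
      }
    }
  open Setoid ≋-setoid public using () renaming (refl to ≋-refl; sym to ≋-sym; trans to ≋-trans)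
  module ≋-Reasoning = SetoidReasoning ≋-setoid

  ∷-cong : ∀ {a b f g} → a ≈ b → f ≋ g → (a ∷ f) ≋ (b ∷ g)
  ∷-cong a≈b (coeffwise f≈g) = coeffwise λ { zero → a≈b ; (suc i) → f≈g i }

  coeff-+ₚ : ∀ f g i → coeff (f +ₚ g) i ≈ coeff f i + coeff g i
  coeff-+ₚ []      g       i       = sym (+-identityˡ _)
  coeff-+ₚ (a ∷ f) []      i       = sym (+-identityʳ _)
  coeff-+ₚ (a ∷ f) (b ∷ g) zero    = refl
  coeff-+ₚ (a ∷ f) (b ∷ g) (suc i) = coeff-+ₚ f g i

  coeff-scale : ∀ a g i → coeff (map (a *_) g) i ≈ a * coeff g i
  coeff-scale a []      i       = sym (zeroʳ a)
  coeff-scale a (b ∷ g) zero    = refl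
  coeff-scale a (b ∷ g) (suc i) = coeff-scale a g i

  coeff-*ₚ-zero : ∀ a f g → coeff ((a ∷ f) *ₚ g) 0 ≈ a * coeff g 0
  coeff-*ₚ-zero a f g = begin
    coeff ((a ∷ f) *ₚ g) 0         ≈⟨ coeff-+ₚ (map (a *_) g) (0# ∷ (f *ₚ g)) 0 ⟩
    coeff (map (a *_) g) 0 + 0#   ≈⟨ +-identityʳ _ ⟩
    coeff (map (a *_) g) 0        ≈⟨ coeff-scale a g 0 ⟩
    a * coeff g 0                 ∎

  coeff-*ₚ-suc : ∀ a f g i → coeff ((a ∷ f) *ₚ g) (suc i) ≈ a * coeff g (suc i) + coeff (f *ₚ g) i
  coeff-*ₚ-suc a f g i =
    trans (coeff-+ₚ (map (a *_) g) (0# ∷ (f *ₚ g)) (suc i)) (+-congʳ (coeff-scale a g (suc i)))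

  +ₚ-cong : ∀ {f f′ g g′} → f ≋ f′ → g ≋ g′ → (f +ₚ g) ≋ (f′ +ₚ g′)
  +ₚ-cong {f} {f′} {g} {g′} (coeffwise f≈f′) (coeffwise g≈g′) = coeffwise λ i → begin
    coeff (f +ₚ g) i         ≈⟨ coeff-+ₚ f g i ⟩
    coeff f i + coeff g i    ≈⟨ +-cong (f≈f′ i) (g≈g′ i) ⟩
    coeff f′ i + coeff g′ i  ≈⟨ coeff-+ₚ f′ g′ i ⟨
    coeff (f′ +ₚ g′) i       ∎

  +ₚ-identityʳ : ∀ f → (f +ₚ []) ≋ f
  +ₚ-identityʳ f = coeffwise λ i → trans (coeff-+ₚ f [] i) (+-identityʳ _)

  *ₚ-zeroˡ : ∀ f g → f ≈ₚ [] → (f *ₚ g) ≈ₚ []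
  *ₚ-zeroˡ []      g f≈0 i       = refl
  *ₚ-zeroˡ (a ∷ f) g f≈0 zero    = trans (coeff-*ₚ-zero a f g) (trans (*-congʳ (f≈0 0)) (zeroˡ _))
  *ₚ-zeroˡ (a ∷ f) g f≈0 (suc i) = begin
    coeff ((a ∷ f) *ₚ g) (suc i)            ≈⟨ coeff-*ₚ-suc a f g i ⟩
    a * coeff g (suc i) + coeff (f *ₚ g) i  ≈⟨ +-cong (trans (*-congʳ (f≈0 0)) (zeroˡ _)) (*ₚ-zeroˡ f g (f≈0 ∘ suc) i) ⟩
    0# + 0#                                 ≈⟨ +-identityˡ 0# ⟩
    0#                                      ∎

  *ₚ-congˡ : ∀ f {g g′} → g ≋ g′ → (f *ₚ g) ≋ (f *ₚ g′)
  *ₚ-congˡ f {g} {g′} (coeffwise g≈g′) = coeffwise (go f)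
    where
    go : ∀ f → (f *ₚ g) ≈ₚ (f *ₚ g′)
    go []      i       = refl
    go (a ∷ f) zero    = begin
      coeff ((a ∷ f) *ₚ g) 0   ≈⟨ coeff-*ₚ-zero a f g ⟩
      a * coeff g 0            ≈⟨ *-congˡ (g≈g′ 0) ⟩
      a * coeff g′ 0           ≈⟨ coeff-*ₚ-zero a f g′ ⟨
      coeff ((a ∷ f) *ₚ g′) 0  ∎
    go (a ∷ f) (suc i) = begin
      coeff ((a ∷ f) *ₚ g) (suc i)              ≈⟨ coeff-*ₚ-suc a f g i ⟩
      a * coeff g (suc i) + coeff (f *ₚ g) i    ≈⟨ +-cong (*-congˡ (g≈g′ (suc i))) (go f i) ⟩
      a * coeff g′ (suc i) + coeff (f *ₚ g′) i  ≈⟨ coeff-*ₚ-suc a f g′ i ⟨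
      coeff ((a ∷ f) *ₚ g′) (suc i)             ∎

  *ₚ-distribʳ-+ₚ : ∀ h u v → ((u +ₚ v) *ₚ h) ≋ ((u *ₚ h) +ₚ (v *ₚ h))
  *ₚ-distribʳ-+ₚ h u v = coeffwise (go u v)
    where
    go : ∀ u v → ((u +ₚ v) *ₚ h) ≈ₚ ((u *ₚ h) +ₚ (v *ₚ h))
    go []      v       i       = refl
    go (a ∷ u) []      i       = sym (coeff-≈ (+ₚ-identityʳ ((a ∷ u) *ₚ h)) i)
    go (a ∷ u) (b ∷ v) zero    = begin
      coeff (((a + b) ∷ (u +ₚ v)) *ₚ h) 0                    ≈⟨ coeff-*ₚ-zero (a + b) (u +ₚ v) h ⟩
      (a + b) * coeff h 0                                    ≈⟨ distribʳ _ a b ⟩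
      a * coeff h 0 + b * coeff h 0                          ≈⟨ +-cong (coeff-*ₚ-zero a u h) (coeff-*ₚ-zero b v h) ⟨
      coeff ((a ∷ u) *ₚ h) 0 + coeff ((b ∷ v) *ₚ h) 0        ≈⟨ coeff-+ₚ ((a ∷ u) *ₚ h) ((b ∷ v) *ₚ h) 0 ⟨
      coeff (((a ∷ u) *ₚ h) +ₚ ((b ∷ v) *ₚ h)) 0             ∎
    go (a ∷ u) (b ∷ v) (suc i) = begin
      coeff (((a + b) ∷ (u +ₚ v)) *ₚ h) (suc i)              ≈⟨ coeff-*ₚ-suc (a + b) (u +ₚ v) h i ⟩
      (a + b) * H + coeff ((u +ₚ v) *ₚ h) i                  ≈⟨ +-congˡ (trans (go u v i) (coeff-+ₚ (u *ₚ h) (v *ₚ h) i)) ⟩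
      (a + b) * H + (P + Q)                                  ≈⟨ solve 5 (λ a b H P Q → (a :+ b) :* H :+ (P :+ Q) :=
                                                                  (a :* H :+ P) :+ (b :* H :+ Q)) refl a b H P Q ⟩
      (a * H + P) + (b * H + Q)                              ≈⟨ +-cong (coeff-*ₚ-suc a u h i) (coeff-*ₚ-suc b v h i) ⟨
      coeff ((a ∷ u) *ₚ h) (suc i) + coeff ((b ∷ v) *ₚ h) (suc i) ≈⟨ coeff-+ₚ ((a ∷ u) *ₚ h) ((b ∷ v) *ₚ h) (suc i) ⟨
      coeff (((a ∷ u) *ₚ h) +ₚ ((b ∷ v) *ₚ h)) (suc i)       ∎
      where
      H = coeff h (suc i)
      P = coeff (u *ₚ h) i
      Q = coeff (v *ₚ h) i

  scale-*ₚ : ∀ a g h → ((map (a *_) g) *ₚ h) ≋ map (a *_) (g *ₚ h)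
  scale-*ₚ a g h = coeffwise (go g)
    where
    go : ∀ g → ((map (a *_) g) *ₚ h) ≈ₚ map (a *_) (g *ₚ h)
    go []      i       = refl
    go (b ∷ g) zero    = begin
      coeff (((a * b) ∷ map (a *_) g) *ₚ h) 0  ≈⟨ coeff-*ₚ-zero (a * b) (map (a *_) g) h ⟩
      (a * b) * coeff h 0                      ≈⟨ *-assoc a b _ ⟩
      a * (b * coeff h 0)                      ≈⟨ *-congˡ (coeff-*ₚ-zero b g h) ⟨
      a * coeff ((b ∷ g) *ₚ h) 0               ≈⟨ coeff-scale a ((b ∷ g) *ₚ h) 0 ⟨
      coeff (map (a *_) ((b ∷ g) *ₚ h)) 0      ∎
    go (b ∷ g) (suc i) = begin
      coeff (((a * b) ∷ map (a *_) g) *ₚ h) (suc i)  ≈⟨ coeff-*ₚ-suc (a * b) (map (a *_) g) h i ⟩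
      (a * b) * H + coeff (map (a *_) g *ₚ h) i      ≈⟨ +-congˡ (trans (go g i) (coeff-scale a (g *ₚ h) i)) ⟩
      (a * b) * H + a * P                            ≈⟨ solve 4 (λ a b H P → (a :* b) :* H :+ a :* P := a :* (b :* H :+ P))
                                                                  refl a b H P ⟩
      a * (b * H + P)                                ≈⟨ *-congˡ (coeff-*ₚ-suc b g h i) ⟨
      a * coeff ((b ∷ g) *ₚ h) (suc i)               ≈⟨ coeff-scale a ((b ∷ g) *ₚ h) (suc i) ⟨
      coeff (map (a *_) ((b ∷ g) *ₚ h)) (suc i)      ∎
      where
      H = coeff h (suc i)
      P = coeff (g *ₚ h) i

  0∷-*ₚ : ∀ u h → ((0# ∷ u) *ₚ h) ≋ (0# ∷ (u *ₚ h))
  0∷-*ₚ u h = coeffwise λ i → begin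
    coeff ((0# ∷ u) *ₚ h) i                              ≈⟨ coeff-+ₚ (map (0# *_) h) (0# ∷ (u *ₚ h)) i ⟩
    coeff (map (0# *_) h) i + coeff (0# ∷ (u *ₚ h)) i    ≈⟨ +-congʳ (trans (coeff-scale 0# h i) (zeroˡ _)) ⟩
    0# + coeff (0# ∷ (u *ₚ h)) i                         ≈⟨ +-identityˡ _ ⟩
    coeff (0# ∷ (u *ₚ h)) i                              ∎

  *ₚ-assoc : ∀ f g h → ((f *ₚ g) *ₚ h) ≋ (f *ₚ (g *ₚ h))
  *ₚ-assoc []      g h = ≋-refl
  *ₚ-assoc (a ∷ f) g h =
    ≋-trans (*ₚ-distribʳ-+ₚ h (map (a *_) g) (0# ∷ (f *ₚ g)))
      (+ₚ-cong (scale-*ₚ a g h) (≋-trans (0∷-*ₚ (f *ₚ g) h) (∷-cong refl (*ₚ-assoc f g h))))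

  *ₚ-identityˡ : ∀ h → ((1# ∷ []) *ₚ h) ≋ h
  *ₚ-identityˡ h = coeffwise λ i → begin
    coeff ((1# ∷ []) *ₚ h) i                       ≈⟨ coeff-+ₚ (map (1# *_) h) (0# ∷ []) i ⟩
    coeff (map (1# *_) h) i + coeff (0# ∷ []) i    ≈⟨ +-cong (trans (coeff-scale 1# h i) (*-identityˡ _)) (coeff-0∷[] i) ⟩
    coeff h i + 0#                                 ≈⟨ +-identityʳ _ ⟩
    coeff h i                                      ∎
    where
    coeff-0∷[] : ∀ i → coeff (0# ∷ []) i ≈ 0#
    coeff-0∷[] zero    = refl
    coeff-0∷[] (suc i) = refl

  shift : ℕ → Pol → Pol
  shift n u = replicate n 0# ++ u

  shift-≈[] : ∀ n u → u ≈ₚ [] → shift n u ≈ₚ []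
  shift-≈[] zero    u u≈0 i       = u≈0 i
  shift-≈[] (suc n) u u≈0 zero    = refl
  shift-≈[] (suc n) u u≈0 (suc i) = shift-≈[] n u u≈0 i

  shift-cong : ∀ n {u v} → u ≋ v → shift n u ≋ shift n v
  shift-cong zero    u≋v = u≋v
  shift-cong (suc n) u≋v = ∷-cong refl (shift-cong n u≋v)

  shift-shift : ∀ m n u → shift m (shift n u) ≡ shift (m ℕ.+ n) u
  shift-shift zero    n u = ≡.refl
  shift-shift (suc m) n u = ≡.cong (0# ∷_) (shift-shift m n u)

  shift-+ₚ : ∀ n u v → (shift n u +ₚ shift n v) ≋ shift n (u +ₚ v)
  shift-+ₚ zero    u v = ≋-refl
  shift-+ₚ (suc n) u v = ∷-cong (+-identityˡ 0#) (shift-+ₚ n u v)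

  scale-shift : ∀ a n u → map (a *_) (shift n u) ≋ shift n (map (a *_) u)
  scale-shift a zero    u = ≋-refl
  scale-shift a (suc n) u = ∷-cong (zeroʳ a) (scale-shift a n u)

  shift-*ₚ : ∀ n u h → (shift n u *ₚ h) ≋ shift n (u *ₚ h)
  shift-*ₚ zero    u h = ≋-refl
  shift-*ₚ (suc n) u h = ≋-trans (0∷-*ₚ (shift n u) h) (∷-cong refl (shift-*ₚ n u h))

  ∣ₚ-respʳ-≋ : ∀ f {g g′} → f ∣ₚ g → g ≋ g′ → f ∣ₚ g′
  ∣ₚ-respʳ-≋ f (h , fh≈g) (coeffwise g≈g′) = h , λ i → trans (fh≈g i) (g≈g′ i)

module Evaluation {c ℓ} (F : Field c ℓ) where
  open Field F hiding (zero)
  open Poly F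
  open FieldProperties F
  open PolynomialArithmetic F
  open import Data.List using ([]; _∷_; map)
  open import Relation.Binary.Reasoning.Setoid setoid
  open import Algebra.Solver.Ring.NaturalCoefficients.Default commutativeSemiring
    using (solve; _:+_; _:*_; _:=_)

  eval-+ₚ : ∀ f g x → eval (f +ₚ g) x ≈ eval f x + eval g x
  eval-+ₚ []      g       x = sym (+-identityˡ _)
  eval-+ₚ (a ∷ f) []      x = sym (+-identityʳ _)
  eval-+ₚ (a ∷ f) (b ∷ g) x = begin
    (a + b) + x * eval (f +ₚ g) x             ≈⟨ +-congˡ (*-congˡ (eval-+ₚ f g x)) ⟩
    (a + b) + x * (eval f x + eval g x)       ≈⟨ solve 5 (λ a b x F G → (a :+ b) :+ x :* (F :+ G) := (a :+ x :* F) :+ (b :+ x :* G))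
                                                     refl a b x (eval f x) (eval g x) ⟩
    (a + x * eval f x) + (b + x * eval g x)   ∎

  eval-scale : ∀ a g x → eval (map (a *_) g) x ≈ a * eval g x
  eval-scale a []      x = sym (zeroʳ a)
  eval-scale a (b ∷ g) x = begin
    a * b + x * eval (map (a *_) g) x  ≈⟨ +-congˡ (*-congˡ (eval-scale a g x)) ⟩
    a * b + x * (a * eval g x)         ≈⟨ solve 4 (λ a b x G → a :* b :+ x :* (a :* G) := a :* (b :+ x :* G))
                                              refl a b x (eval g x) ⟩
    a * (b + x * eval g x)             ∎

  eval-*ₚ : ∀ f g x → eval (f *ₚ g) x ≈ eval f x * eval g x
  eval-*ₚ []      g x = sym (zeroˡ _)
  eval-*ₚ (a ∷ f) g x = begin
    eval (map (a *_) g +ₚ (0# ∷ (f *ₚ g))) x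
      ≈⟨ eval-+ₚ (map (a *_) g) (0# ∷ (f *ₚ g)) x ⟩
    eval (map (a *_) g) x + (0# + x * eval (f *ₚ g) x)
      ≈⟨ +-cong (eval-scale a g x) (trans (+-identityˡ _) (*-congˡ (eval-*ₚ f g x))) ⟩
    a * eval g x + x * (eval f x * eval g x)
      ≈⟨ solve 4 (λ a x F G → a :* G :+ x :* (F :* G) := (a :+ x :* F) :* G) refl a x (eval f x) (eval g x) ⟩
    (a + x * eval f x) * eval g x
      ∎

  eval-≈[] : ∀ f x → f ≈ₚ [] → eval f x ≈ 0#
  eval-≈[] []      x f≈0 = refl
  eval-≈[] (a ∷ f) x f≈0 = begin
    a + x * eval f x  ≈⟨ +-cong (f≈0 0) (*-congˡ (eval-≈[] f x (f≈0 ∘ suc))) ⟩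
    0# + x * 0#       ≈⟨ +-identityˡ _ ⟩
    x * 0#            ≈⟨ zeroʳ x ⟩
    0#                ∎

  eval-congˡ : ∀ {f g} x → f ≋ g → eval f x ≈ eval g x
  eval-congˡ {f} {g} x (coeffwise f≈g) = go f g f≈g
    where
    go : ∀ f g → f ≈ₚ g → eval f x ≈ eval g x
    go []      []      f≈g = refl
    go []      (b ∷ g) f≈g = sym (eval-≈[] (b ∷ g) x (λ i → sym (f≈g i)))
    go (a ∷ f) []      f≈g = eval-≈[] (a ∷ f) x f≈g
    go (a ∷ f) (b ∷ g) f≈g = +-cong (f≈g 0) (*-congˡ (go f g (λ i → f≈g (suc i))))

  eval-congʳ : ∀ f {x y} → x ≈ y → eval f x ≈ eval f y
  eval-congʳ []      x≈y = refl
  eval-congʳ (a ∷ f) x≈y = +-congˡ (*-cong x≈y (eval-congʳ f x≈y))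

  eval-const : ∀ a x → eval (a ∷ []) x ≈ a
  eval-const a x = trans (+-congˡ (zeroʳ x)) (+-identityʳ a)

  eval-shift : ∀ n u x → eval (shift n u) x ≈ x ^ n * eval u x
  eval-shift zero    u x = sym (*-identityˡ _)
  eval-shift (suc n) u x = begin
    0# + x * eval (shift n u) x  ≈⟨ +-identityˡ _ ⟩
    x * eval (shift n u) x       ≈⟨ *-congˡ (eval-shift n u x) ⟩
    x * (x ^ n * eval u x)       ≈⟨ *-assoc _ _ _ ⟨
    x ^ suc n * eval u x         ∎

  eval-xⁿ-1 : ∀ n x → eval (xⁿ-1 n) x ≈ x ^ n - 1#
  eval-xⁿ-1 n x = begin
    eval (shift n (1# ∷ []) +ₚ (- 1# ∷ [])) x          ≈⟨ eval-+ₚ (shift n (1# ∷ [])) (- 1# ∷ []) x ⟩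
    eval (shift n (1# ∷ [])) x + eval (- 1# ∷ []) x    ≈⟨ +-cong (eval-shift n (1# ∷ []) x) (eval-const _ x) ⟩
    x ^ n * eval (1# ∷ []) x - 1#                      ≈⟨ +-congʳ (trans (*-congˡ (eval-const 1# x)) (*-identityʳ _)) ⟩
    x ^ n - 1#                                         ∎

module Degree {c ℓ} (F : Field c ℓ) where
  open Field F hiding (zero)
  open Poly F
  open PolynomialArithmetic F
  open import Data.List using ([]; _∷_; map)
  open import Relation.Binary.Reasoning.Setoid setoid

  DegreeAtMost : Pol → ℕ → Set ℓ
  DegreeAtMost p n = ∀ i → n < i → coeff p i ≈ 0#

  record MonicOfDegree (p : Pol) (n : ℕ) : Set ℓ where
    constructor monic
    field
      leading≈1 : coeff p n ≈ 1#
      degree≤   : DegreeAtMost p n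
  open MonicOfDegree public

  monic⇒hasDegree : ∀ {p n} → MonicOfDegree p n → HasDegree p n
  monic⇒hasDegree (monic lead≈1 above≈0) = (λ lead≈0 → 0≉1 (trans (sym lead≈0) lead≈1)) , above≈0

  monic-cong : ∀ {f g n} → f ≋ g → MonicOfDegree f n → MonicOfDegree g n
  monic-cong (coeffwise f≈g) (monic lead≈1 above≈0) =
    monic (trans (sym (f≈g _)) lead≈1) λ i n<i → trans (sym (f≈g i)) (above≈0 i n<i)

  ∷-monic : ∀ {a f n} → MonicOfDegree f n → MonicOfDegree (a ∷ f) (suc n)
  ∷-monic (monic lead≈1 above≈0) = monic lead≈1 λ { (suc i) (s≤s n<i) → above≈0 i n<i }

  ∷-monic⁻ : ∀ {a f n} → MonicOfDegree (a ∷ f) (suc n) → MonicOfDegree f n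
  ∷-monic⁻ (monic lead≈1 above≈0) = monic lead≈1 λ i n<i → above≈0 (suc i) (s≤s n<i)

  1-monic : MonicOfDegree (1# ∷ []) 0
  1-monic = monic refl λ { (suc i) _ → refl }

  shift-monic : ∀ n {u m} → MonicOfDegree u m → MonicOfDegree (shift n u) (n ℕ.+ m)
  shift-monic zero    u-monic = u-monic
  shift-monic (suc n) u-monic = ∷-monic (shift-monic n u-monic)

  xⁿ-1-monic : ∀ n → MonicOfDegree (xⁿ-1 (suc n)) (suc n)
  xⁿ-1-monic n = ∷-monic (monic-cong (≋-sym (+ₚ-identityʳ _))
    (≡.subst (MonicOfDegree (shift n (1# ∷ []))) (ℕ.+-identityʳ n) (shift-monic n 1-monic)))

  +ₚ-monicʳ : ∀ {u v j k} → DegreeAtMost u j → j < k → MonicOfDegree v k → MonicOfDegree (u +ₚ v) k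
  +ₚ-monicʳ {u} {v} {j} {k} u≤j j<k (monic lead≈1 above≈0) = monic lead above
    where
    lead : coeff (u +ₚ v) k ≈ 1#
    lead = begin
      coeff (u +ₚ v) k       ≈⟨ coeff-+ₚ u v k ⟩
      coeff u k + coeff v k  ≈⟨ +-cong (u≤j k j<k) lead≈1 ⟩
      0# + 1#                ≈⟨ +-identityˡ 1# ⟩
      1#                     ∎
    above : DegreeAtMost (u +ₚ v) k
    above i k<i = begin
      coeff (u +ₚ v) i       ≈⟨ coeff-+ₚ u v i ⟩
      coeff u i + coeff v i  ≈⟨ +-cong (u≤j i (ℕ.<-trans j<k k<i)) (above≈0 i k<i) ⟩
      0# + 0#                ≈⟨ +-identityˡ 0# ⟩
      0#                     ∎

  scale-degree : ∀ a g {n} → DegreeAtMost g n → DegreeAtMost (map (a *_) g) n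
  scale-degree a g g≤n i n<i = trans (coeff-scale a g i) (trans (*-congˡ (g≤n i n<i)) (zeroʳ a))

  *ₚ-monic : ∀ {f g m n} → MonicOfDegree f m → MonicOfDegree g n → MonicOfDegree (f *ₚ g) (m ℕ.+ n)
  *ₚ-monic {[]}    (monic 0≈1 _) _ = ⊥-elim (0≉1 0≈1)
  *ₚ-monic {a ∷ f} {g} {zero} (monic a≈1 f≈0) g-monic = monic-cong (≋-sym fg≋g) g-monic
    where
    fg≋g : ((a ∷ f) *ₚ g) ≋ g
    fg≋g = coeffwise λ i → begin
      coeff (map (a *_) g +ₚ (0# ∷ (f *ₚ g))) i            ≈⟨ coeff-+ₚ (map (a *_) g) (0# ∷ (f *ₚ g)) i ⟩
      coeff (map (a *_) g) i + coeff (0# ∷ (f *ₚ g)) i    ≈⟨ +-cong (coeff-scale a g i) (tail≈0 i) ⟩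
      a * coeff g i + 0#                                  ≈⟨ +-identityʳ _ ⟩
      a * coeff g i                                       ≈⟨ *-congʳ a≈1 ⟩
      1# * coeff g i                                      ≈⟨ *-identityˡ _ ⟩
      coeff g i                                           ∎
      where
      tail≈0 : ∀ i → coeff (0# ∷ (f *ₚ g)) i ≈ 0#
      tail≈0 zero    = refl
      tail≈0 (suc i) = *ₚ-zeroˡ f g (λ j → f≈0 (suc j) (s≤s z≤n)) i
  *ₚ-monic {a ∷ f} {g} {suc m} {n} f-monic g-monic =
    +ₚ-monicʳ (scale-degree a g (degree≤ g-monic)) (s≤s (ℕ.m≤n+m n m))
      (∷-monic (*ₚ-monic (∷-monic⁻ f-monic) g-monic))

module FactorTheorem {c ℓ} (F : Field c ℓ) where
  open Field F hiding (zero)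
  open Poly F
  open FieldProperties F
  open PolynomialArithmetic F
  open Evaluation F
  open Degree F
  open import Data.List using ([]; _∷_; drop)
  open import Relation.Binary.Reasoning.Setoid setoid

  x-_ : Carrier → Pol
  x- b = - b ∷ 1# ∷ []

  _/[x-_] : Pol → Carrier → Pol
  []      /[x- b ] = []
  (a ∷ p) /[x- b ] = eval p b ∷ (p /[x- b ])

  x--monic : ∀ b → MonicOfDegree (x- b) 1
  x--monic b = monic refl λ { (suc zero) (s≤s ()) ; (suc (suc i)) _ → refl }

  eval-x- : ∀ b y → eval (x- b) y ≈ y - b
  eval-x- b y = begin
    - b + y * eval (1# ∷ []) y  ≈⟨ +-congˡ (*-congˡ (eval-const 1# y)) ⟩
    - b + y * 1#                ≈⟨ +-comm _ _ ⟩
    y * 1# - b                  ≈⟨ +-congʳ (*-identityʳ y) ⟩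
    y - b                       ∎

  coeff-/[x-] : ∀ b p i → coeff (p /[x- b ]) i ≡ eval (drop (suc i) p) b
  coeff-/[x-] b []      i       = ≡.refl
  coeff-/[x-] b (a ∷ p) zero    = ≡.refl
  coeff-/[x-] b (a ∷ p) (suc i) = coeff-/[x-] b p i

  eval-drop : ∀ m p b → eval (drop m p) b ≈ coeff p m + b * eval (drop (suc m) p) b
  eval-drop zero    []      b = sym (trans (+-congˡ (zeroʳ b)) (+-identityʳ _))
  eval-drop zero    (a ∷ p) b = refl
  eval-drop (suc m) []      b = sym (trans (+-congˡ (zeroʳ b)) (+-identityʳ _))
  eval-drop (suc m) (a ∷ p) b = eval-drop m p b

  coeff-drop : ∀ m p i → coeff (drop m p) i ≡ coeff p (m ℕ.+ i)
  coeff-drop zero    p       i = ≡.refl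
  coeff-drop (suc m) []      i = ≡.refl
  coeff-drop (suc m) (a ∷ p) i = coeff-drop m p i

  eval-drop-≈0 : ∀ {n} m p b → DegreeAtMost p n → n < m → eval (drop m p) b ≈ 0#
  eval-drop-≈0 m p b p≤n n<m = eval-≈[] (drop m p) b λ j →
    ≡.subst (_≈ 0#) (≡.sym (coeff-drop m p j)) (p≤n (m ℕ.+ j) (ℕ.<-≤-trans n<m (ℕ.m≤m+n m j)))

  eval-drop-degree : ∀ {n} p b → DegreeAtMost p n → eval (drop n p) b ≈ coeff p n
  eval-drop-degree {n} p b p≤n = begin
    eval (drop n p) b                        ≈⟨ eval-drop n p b ⟩
    coeff p n + b * eval (drop (suc n) p) b  ≈⟨ +-congˡ (*-congˡ (eval-drop-≈0 (suc n) p b p≤n ℕ.≤-refl)) ⟩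
    coeff p n + b * 0#                       ≈⟨ +-congˡ (zeroʳ b) ⟩
    coeff p n + 0#                           ≈⟨ +-identityʳ _ ⟩
    coeff p n                                ∎

  coeff-*ₚ-x- : ∀ b h i → coeff ((x- b) *ₚ h) (suc i) ≈ - b * coeff h (suc i) + coeff h i
  coeff-*ₚ-x- b h i = trans (coeff-*ₚ-suc (- b) (1# ∷ []) h i) (+-congˡ (coeff-≈ (*ₚ-identityˡ h) i))

  remainder-theorem : ∀ b p → ((eval p b ∷ []) +ₚ ((x- b) *ₚ (p /[x- b ]))) ≋ p
  remainder-theorem b p = coeffwise λ
    { zero → begin
        coeff ((eval p b ∷ []) +ₚ ((x- b) *ₚ q)) 0
          ≈⟨ coeff-+ₚ (eval p b ∷ []) ((x- b) *ₚ q) 0 ⟩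
        eval p b + coeff ((x- b) *ₚ q) 0
          ≈⟨ +-cong (eval-drop 0 p b) (coeff-*ₚ-zero (- b) (1# ∷ []) q) ⟩
        (coeff p 0 + b * Q 0) + - b * coeff q 0
          ≡⟨ ≡.cong (λ t → (coeff p 0 + b * Q 0) + - b * t) (coeff-/[x-] b p 0) ⟩
        (coeff p 0 + b * Q 0) + - b * Q 0
          ≈⟨ +-comm _ _ ⟩
        - b * Q 0 + (coeff p 0 + b * Q 0)
          ≈⟨ -[x*y]+[z+x*y]≈z b (Q 0) (coeff p 0) ⟩
        coeff p 0
          ∎
    ; (suc i) → begin
        coeff ((eval p b ∷ []) +ₚ ((x- b) *ₚ q)) (suc i)
          ≈⟨ coeff-+ₚ (eval p b ∷ []) ((x- b) *ₚ q) (suc i) ⟩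
        0# + coeff ((x- b) *ₚ q) (suc i)
          ≈⟨ trans (+-identityˡ _) (coeff-*ₚ-x- b q i) ⟩
        - b * coeff q (suc i) + coeff q i
          ≡⟨ ≡.cong₂ (λ s t → - b * s + t) (coeff-/[x-] b p (suc i)) (coeff-/[x-] b p i) ⟩
        - b * Q (suc i) + eval (drop (suc i) p) b
          ≈⟨ +-congˡ (eval-drop (suc i) p b) ⟩
        - b * Q (suc i) + (coeff p (suc i) + b * Q (suc i))
          ≈⟨ -[x*y]+[z+x*y]≈z b (Q (suc i)) (coeff p (suc i)) ⟩
        coeff p (suc i)
          ∎
    }
    where
    q = p /[x- b ]
    Q : ℕ → Carrier
    Q i = eval (drop (suc i) p) b

  factor-theorem : ∀ b p → eval p b ≈ 0# → ((x- b) *ₚ (p /[x- b ])) ≋ p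
  factor-theorem b p pb≈0 = ≋-trans (+ₚ-cong {f = []} {g = q} pb≈0-as-poly ≋-refl) (remainder-theorem b p)
    where
    q = (x- b) *ₚ (p /[x- b ])
    pb≈0-as-poly : [] ≋ (eval p b ∷ [])
    pb≈0-as-poly = coeffwise λ { zero → sym pb≈0 ; (suc i) → refl }

  root-of-quotient : ∀ {b y} p → eval p b ≈ 0# → eval p y ≈ 0# → ¬ y ≈ b → eval (p /[x- b ]) y ≈ 0#
  root-of-quotient {b} {y} p pb≈0 py≈0 y≉b = x≉0∧xy≈0⇒y≈0 (λ y-b≈0 → y≉b (x∙y⁻¹≈ε⇒x≈y y b y-b≈0)) (begin
    (y - b) * eval (p /[x- b ]) y         ≈⟨ *-congʳ (eval-x- b y) ⟨
    eval (x- b) y * eval (p /[x- b ]) y   ≈⟨ eval-*ₚ (x- b) (p /[x- b ]) y ⟨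
    eval ((x- b) *ₚ (p /[x- b ])) y       ≈⟨ eval-congˡ y (factor-theorem b p pb≈0) ⟩
    eval p y                              ≈⟨ py≈0 ⟩
    0#                                    ∎)

  /[x-]-monic : ∀ b {p n} → MonicOfDegree p (suc n) → MonicOfDegree (p /[x- b ]) n
  /[x-]-monic b {p} {n} (monic lead≈1 p≤1+n) =
    monic (trans (reflexive (coeff-/[x-] b p n)) (trans (eval-drop-degree p b p≤1+n) lead≈1))
      λ i n<i → trans (reflexive (coeff-/[x-] b p i)) (eval-drop-≈0 (suc i) p b p≤1+n (s≤s n<i))

module Roots {c ℓ} (F : Field c ℓ) where
  open Field F hiding (zero)
  open Poly F
  open PolynomialArithmetic F
  open Evaluation F
  open Degree F
  open FieldProperties F
  open FactorTheorem F
  open import Data.List using (List; []; _∷_; length)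
  open import Data.List.Relation.Unary.All as All using (All; []; _∷_)
  open import Data.List.Relation.Unary.AllPairs using (AllPairs; []; _∷_)

  IsRoot : Pol → Carrier → Set ℓ
  IsRoot p b = eval p b ≈ 0#

  Distinct : List Carrier → Set (c Level.⊔ ℓ)
  Distinct = AllPairs (λ a b → ¬ a ≈ b)

  roots-of-quotient : ∀ {b bs} p → IsRoot p b → All (λ b′ → ¬ b ≈ b′) bs → All (IsRoot p) bs →
                      All (IsRoot (p /[x- b ])) bs
  roots-of-quotient p pb≈0 b≉bs bs-roots =
    All.zipWith (λ (b≉b′ , pb′≈0) → root-of-quotient p pb≈0 pb′≈0 (b≉b′ ∘ sym)) (b≉bs , bs-roots)

  monic-degree-0-no-root : ∀ {p} b → MonicOfDegree p 0 → ¬ IsRoot p b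
  monic-degree-0-no-root {p} b (monic lead≈1 p≤0) pb≈0 =
    0≉1 (trans (sym pb≈0) (trans (eval-drop-degree p b p≤0) lead≈1))

  monic-roots-bound : ∀ {p n bs} → MonicOfDegree p n → Distinct bs → All (IsRoot p) bs → length bs ≤ n
  monic-roots-bound                   p-monic []                 []                = z≤n
  monic-roots-bound {p} {zero}  {b ∷ _} p-monic (_ ∷ _)            (pb≈0 ∷ _)        =
    ⊥-elim (monic-degree-0-no-root b p-monic pb≈0)
  monic-roots-bound {p} {suc n} {b ∷ _} p-monic (b≉bs ∷ distinct) (pb≈0 ∷ bs-roots) =
    s≤s (monic-roots-bound (/[x-]-monic b p-monic) distinct (roots-of-quotient p pb≈0 b≉bs bs-roots))

  ∏x-_ : List Carrier → Pol
  ∏x- []       = 1# ∷ []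
  ∏x- (b ∷ bs) = (x- b) *ₚ (∏x- bs)

  ∏x--monic : ∀ bs → MonicOfDegree (∏x- bs) (length bs)
  ∏x--monic []       = 1-monic
  ∏x--monic (b ∷ bs) = *ₚ-monic (x--monic b) (∏x--monic bs)

  eval-∏x--≉0 : ∀ {y} bs → All (λ b → ¬ y ≈ b) bs → ¬ eval (∏x- bs) y ≈ 0#
  eval-∏x--≉0 {y} []       []           1≈0 = 0≉1 (trans (sym 1≈0) (eval-const 1# y))
  eval-∏x--≉0 {y} (b ∷ bs) (y≉b ∷ y≉bs) =
    *-≉0 (λ y-b≈0 → y≉b (x∙y⁻¹≈ε⇒x≈y y b (trans (sym (eval-x- b y)) y-b≈0))) (eval-∏x--≉0 bs y≉bs)
      ∘ trans (sym (eval-*ₚ (x- b) (∏x- bs) y))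

  ∏x--divides : ∀ {bs} p → Distinct bs → All (IsRoot p) bs → (∏x- bs) ∣ₚ p
  ∏x--divides p []                 []                = p , coeff-≈ (*ₚ-identityˡ p)
  ∏x--divides {b ∷ bs} p (b≉bs ∷ distinct) (pb≈0 ∷ bs-roots)
    with ∏x--divides (p /[x- b ]) distinct (roots-of-quotient p pb≈0 b≉bs bs-roots)
  ... | g , ∏g≈q = g , coeff-≈ (begin
    ((x- b) *ₚ (∏x- bs)) *ₚ g   ≈⟨ *ₚ-assoc (x- b) (∏x- bs) g ⟩
    (x- b) *ₚ ((∏x- bs) *ₚ g)   ≈⟨ *ₚ-congˡ (x- b) (coeffwise ∏g≈q) ⟩
    (x- b) *ₚ (p /[x- b ])      ≈⟨ factor-theorem b p pb≈0 ⟩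
    p                           ∎)
    where open ≋-Reasoning

  ∏x--extends-divisor : ∀ f g {bs} → f ∣ₚ g → Distinct bs → All (IsRoot g) bs → All (λ b → ¬ IsRoot f b) bs →
                        (f *ₚ (∏x- bs)) ∣ₚ g
  ∏x--extends-divisor f g {bs} (h , fh≈g) distinct g-roots f-nonroots
    with ∏x--divides h distinct (All.zipWith h-root (g-roots , f-nonroots))
    where
    h-root : ∀ {b} → IsRoot g b × ¬ IsRoot f b → IsRoot h b
    h-root {b} (gb≈0 , fb≉0) = x≉0∧xy≈0⇒y≈0 fb≉0
      (trans (sym (eval-*ₚ f h b)) (trans (eval-congˡ b (coeffwise {f *ₚ h} {g} fh≈g)) gb≈0))
  ... | k , ∏k≈h = k , coeff-≈ (begin
    (f *ₚ (∏x- bs)) *ₚ k   ≈⟨ *ₚ-assoc f (∏x- bs) k ⟩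
    f *ₚ ((∏x- bs) *ₚ k)   ≈⟨ *ₚ-congˡ f (coeffwise ∏k≈h) ⟩
    f *ₚ h                 ≈⟨ coeffwise fh≈g ⟩
    g                      ∎)
    where open ≋-Reasoning

module Inflation {c ℓ} (F : Field c ℓ) (m : ℕ) where
  open Field F hiding (zero)
  open Poly F
  open FieldProperties F
  open PolynomialArithmetic F
  open Evaluation F
  open Degree F
  open import Data.List using ([]; _∷_; map)

  -- inflate p is p(x ^ suc m): the offset by one keeps the definition structural.
  inflate : Pol → Pol
  inflate []      = []
  inflate (a ∷ p) = a ∷ shift m (inflate p)

  inflate-≈[] : ∀ p → p ≈ₚ [] → inflate p ≈ₚ []
  inflate-≈[] []      p≈0 i       = refl
  inflate-≈[] (a ∷ p) p≈0 zero    = p≈0 0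
  inflate-≈[] (a ∷ p) p≈0 (suc i) = shift-≈[] m (inflate p) (inflate-≈[] p (λ j → p≈0 (suc j))) i

  inflate-cong : ∀ {f g} → f ≋ g → inflate f ≋ inflate g
  inflate-cong {f} {g} (coeffwise f≈g) = go f g f≈g
    where
    go : ∀ f g → f ≈ₚ g → inflate f ≋ inflate g
    go []      []      f≈g = ≋-refl
    go []      (b ∷ g) f≈g = coeffwise λ i → sym (inflate-≈[] (b ∷ g) (λ j → sym (f≈g j)) i)
    go (a ∷ f) []      f≈g = coeffwise (inflate-≈[] (a ∷ f) f≈g)
    go (a ∷ f) (b ∷ g) f≈g = ∷-cong (f≈g 0) (shift-cong m (go f g (λ i → f≈g (suc i))))

  inflate-+ₚ : ∀ f g → inflate (f +ₚ g) ≋ (inflate f +ₚ inflate g)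
  inflate-+ₚ []      g       = ≋-refl
  inflate-+ₚ (a ∷ f) []      = ≋-sym (+ₚ-identityʳ _)
  inflate-+ₚ (a ∷ f) (b ∷ g) =
    ∷-cong refl (≋-trans (shift-cong m (inflate-+ₚ f g)) (≋-sym (shift-+ₚ m (inflate f) (inflate g))))

  inflate-scale : ∀ a g → inflate (map (a *_) g) ≋ map (a *_) (inflate g)
  inflate-scale a []      = ≋-refl
  inflate-scale a (b ∷ g) =
    ∷-cong refl (≋-trans (shift-cong m (inflate-scale a g)) (≋-sym (scale-shift a m (inflate g))))

  inflate-*ₚ : ∀ f g → inflate (f *ₚ g) ≋ (inflate f *ₚ inflate g)
  inflate-*ₚ []      g = ≋-refl
  inflate-*ₚ (a ∷ f) g = begin
    inflate (map (a *_) g +ₚ (0# ∷ (f *ₚ g)))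
      ≈⟨ inflate-+ₚ (map (a *_) g) (0# ∷ (f *ₚ g)) ⟩
    inflate (map (a *_) g) +ₚ (0# ∷ shift m (inflate (f *ₚ g)))
      ≈⟨ +ₚ-cong (inflate-scale a g) (∷-cong refl (shift-cong m (inflate-*ₚ f g))) ⟩
    map (a *_) (inflate g) +ₚ (0# ∷ shift m (inflate f *ₚ inflate g))
      ≈⟨ +ₚ-cong ≋-refl (∷-cong refl (shift-*ₚ m (inflate f) (inflate g))) ⟨
    map (a *_) (inflate g) +ₚ (0# ∷ (shift m (inflate f) *ₚ inflate g))
      ∎
    where open ≋-Reasoning

  inflate-shift : ∀ n u → inflate (shift n u) ≋ shift (n ℕ.* suc m) (inflate u)
  inflate-shift zero    u = ≋-refl
  inflate-shift (suc n) u = ∷-cong refl (begin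
    shift m (inflate (shift n u))                 ≈⟨ shift-cong m (inflate-shift n u) ⟩
    shift m (shift (n ℕ.* suc m) (inflate u))     ≡⟨ shift-shift m (n ℕ.* suc m) (inflate u) ⟩
    shift (m ℕ.+ n ℕ.* suc m) (inflate u)         ∎)
    where open ≋-Reasoning

  inflate-const : ∀ a → inflate (a ∷ []) ≋ (a ∷ [])
  inflate-const a = ∷-cong refl (coeffwise (shift-≈[] m [] (λ _ → refl)))

  inflate-xⁿ-1 : ∀ n → inflate (xⁿ-1 n) ≋ xⁿ-1 (suc m ℕ.* n)
  inflate-xⁿ-1 n = begin
    inflate (shift n (1# ∷ []) +ₚ (- 1# ∷ []))              ≈⟨ inflate-+ₚ (shift n (1# ∷ [])) (- 1# ∷ []) ⟩
    inflate (shift n (1# ∷ [])) +ₚ inflate (- 1# ∷ [])      ≈⟨ +ₚ-cong (inflate-shift n (1# ∷ [])) (inflate-const (- 1#)) ⟩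
    shift (n ℕ.* suc m) (inflate (1# ∷ [])) +ₚ (- 1# ∷ [])  ≈⟨ +ₚ-cong (shift-cong (n ℕ.* suc m) (inflate-const 1#)) ≋-refl ⟩
    xⁿ-1 (n ℕ.* suc m)                                      ≡⟨ ≡.cong xⁿ-1 (ℕ.*-comm n (suc m)) ⟩
    xⁿ-1 (suc m ℕ.* n)                                      ∎
    where open ≋-Reasoning

  eval-inflate : ∀ p x → eval (inflate p) x ≈ eval p (x ^ suc m)
  eval-inflate []      x = refl
  eval-inflate (a ∷ p) x = +-congˡ (begin
    x * eval (shift m (inflate p)) x   ≈⟨ *-congˡ (eval-shift m (inflate p) x) ⟩
    x * (x ^ m * eval (inflate p) x)   ≈⟨ *-assoc _ _ _ ⟨
    x ^ suc m * eval (inflate p) x     ≈⟨ *-congˡ (eval-inflate p x) ⟩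
    x ^ suc m * eval p (x ^ suc m)     ∎)
    where open import Relation.Binary.Reasoning.Setoid setoid

  inflate-monic : ∀ {f n} → MonicOfDegree f n → MonicOfDegree (inflate f) (n ℕ.* suc m)
  inflate-monic {[]}    (monic 0≈1 _) = ⊥-elim (0≉1 0≈1)
  inflate-monic {a ∷ f} {zero}  (monic a≈1 f≤0) =
    monic a≈1 λ { (suc i) _ → shift-≈[] m (inflate f) (inflate-≈[] f (λ j → f≤0 (suc j) (s≤s z≤n))) i }
  inflate-monic {a ∷ f} {suc n} f-monic = ∷-monic (shift-monic m (inflate-monic (∷-monic⁻ f-monic)))

  inflate-∣ₚ : ∀ f g → f ∣ₚ g → inflate f ∣ₚ inflate g
  inflate-∣ₚ f g (h , fh≈g) = inflate h , coeff-≈ (begin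
    inflate f *ₚ inflate h   ≈⟨ inflate-*ₚ f h ⟨
    inflate (f *ₚ h)         ≈⟨ inflate-cong (coeffwise fh≈g) ⟩
    inflate g                ∎)
    where open ≋-Reasoning

module FiniteFields {c ℓ} (F : Field c ℓ) (n : ℕ) (card : HasCardinality F (suc n)) where
  open Field F hiding (zero)
  open FieldProperties F
  open Evaluation F
  open Degree F
  open Roots F
  open HasCardinality card
  open import Data.Fin as Fin using (Fin; punchIn; punchOut)
  import Data.Fin.Properties as Fin
  open import Data.Fin.Permutation using (permutation)
  import Data.List.Properties as List
  import Data.List.Relation.Unary.All.Properties as All
  import Data.List.Relation.Unary.AllPairs.Properties as AllPairs
  open import Data.Nat.Divisibility using (divides)
  open import Data.Nat.Primality using (prime⇒nonTrivial)
  open import Relation.Binary.Definitions using (Decidable)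
  open import Relation.Nullary.Decidable using (map′)
  import Algebra.Properties.CommutativeMonoid.Sum *-commutativeMonoid as ∏
  open import Relation.Binary.Reasoning.Setoid setoid

  index : Carrier → Fin (suc n)
  index y = proj₁ (surjective y)

  enum-index : ∀ y → enum (index y) ≈ y
  enum-index y = proj₂ (surjective y)

  infix 4 _≈?_
  _≈?_ : Decidable _≈_
  x ≈? y = map′ (λ ix≡iy → trans (sym (enum-index x)) (trans (reflexive (≡.cong enum ix≡iy)) (enum-index y)))
                (λ x≈y → injective _ _ (trans (enum-index x) (trans x≈y (sym (enum-index y)))))
                (index x Fin.≟ index y)

  unit : Fin n → Carrier
  unit j = enum (punchIn (index 0#) j)

  unit-≉0 : ∀ j → ¬ unit j ≈ 0#
  unit-≉0 j uⱼ≈0 = Fin.punchInᵢ≢i (index 0#) j (injective _ _ (trans uⱼ≈0 (sym (enum-index 0#))))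

  unit-injective : ∀ i j → unit i ≈ unit j → i ≡ j
  unit-injective i j uᵢ≈uⱼ = Fin.punchIn-injective (index 0#) i j (injective _ _ uᵢ≈uⱼ)

  unit-index : ∀ y → ¬ y ≈ 0# → Fin n
  unit-index y y≉0 = punchOut {i = index 0#} {j = index y}
    (λ i0≡iy → y≉0 (trans (sym (enum-index y)) (trans (reflexive (≡.cong enum (≡.sym i0≡iy))) (enum-index 0#))))

  unit-unit-index : ∀ y y≉0 → unit (unit-index y y≉0) ≈ y
  unit-unit-index y y≉0 = ≡.subst (λ k → enum k ≈ y) (≡.sym (Fin.punchIn-punchOut _)) (enum-index y)

  scaling : ∀ {x} → ¬ x ≈ 0# → Fin n → Fin n
  scaling {x} x≉0 j = unit-index (x * unit j) (*-≉0 x≉0 (unit-≉0 j))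

  unit-scaling : ∀ {x} (x≉0 : ¬ x ≈ 0#) j → unit (scaling x≉0 j) ≈ x * unit j
  unit-scaling {x} x≉0 j = unit-unit-index (x * unit j) (*-≉0 x≉0 (unit-≉0 j))

  scaling-inverse : ∀ {x y} (x≉0 : ¬ x ≈ 0#) (y≉0 : ¬ y ≈ 0#) → x * y ≈ 1# →
                    ∀ j → scaling x≉0 (scaling y≉0 j) ≡ j
  scaling-inverse {x} {y} x≉0 y≉0 xy≈1 j = unit-injective _ _ (begin
    unit (scaling x≉0 (scaling y≉0 j))  ≈⟨ unit-scaling x≉0 _ ⟩
    x * unit (scaling y≉0 j)            ≈⟨ *-congˡ (unit-scaling y≉0 j) ⟩
    x * (y * unit j)                    ≈⟨ *-assoc x y _ ⟨
    (x * y) * unit j                    ≈⟨ *-congʳ xy≈1 ⟩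
    1# * unit j                         ≈⟨ *-identityˡ _ ⟩
    unit j                              ∎)

  ∏-≉0 : ∀ {k} (f : Fin k → Carrier) → (∀ j → ¬ f j ≈ 0#) → ¬ ∏.sum f ≈ 0#
  ∏-≉0 {zero}  f f≉0 1≈0 = 0≉1 (sym 1≈0)
  ∏-≉0 {suc k} f f≉0     = *-≉0 (f≉0 Fin.zero) (∏-≉0 (f ∘ Fin.suc) (f≉0 ∘ Fin.suc))

  -- Multiplication by x permutes the nonzero elements, so it fixes their product.
  fermat : ∀ {x} → ¬ x ≈ 0# → x ^ n ≈ 1#
  fermat {x} x≉0 with inverse x x≉0
  ... | x⁻¹ , xx⁻¹≈1 = sym (*-cancelʳ-≉0 (∏-≉0 unit unit-≉0) (begin
    1# * ∏.sum unit                    ≈⟨ *-identityˡ _ ⟩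
    ∏.sum unit                         ≈⟨ ∏.sum-permute unit π ⟩
    ∏.sum (unit ∘ scaling x≉0)         ≈⟨ ∏.sum-cong-≋ (unit-scaling x≉0) ⟩
    ∏.sum (λ j → x * unit j)           ≈⟨ ∏.∑-distrib-+ (λ _ → x) unit ⟩
    ∏.sum {n} (λ _ → x) * ∏.sum unit   ≈⟨ *-congʳ (∏.sum-replicate n) ⟩
    x ^ n * ∏.sum unit                 ∎))
    where
    x⁻¹≉0 : ¬ x⁻¹ ≈ 0#
    x⁻¹≉0 x⁻¹≈0 = 0≉1 (trans (sym (trans (*-congˡ x⁻¹≈0) (zeroʳ x))) xx⁻¹≈1)
    π = permutation (scaling x≉0) (scaling x⁻¹≉0)
          (scaling-inverse x≉0 x⁻¹≉0 xx⁻¹≈1)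
          (scaling-inverse x⁻¹≉0 x≉0 (trans (*-comm x⁻¹ x) xx⁻¹≈1))

  -- Otherwise x ^ M - 1 would have all n nonzero elements as roots.
  ∃-non-root-of-unity : ∀ {M} → 0 < M → M < n → ∃ λ x → ¬ x ≈ 0# × ¬ x ^ M ≈ 1#
  ∃-non-root-of-unity {suc M} _ M<n =
    let j , uⱼᴹ≉1 = Fin.¬∀⟶∃¬ n (λ j → unit j ^ suc M ≈ 1#) (λ j → unit j ^ suc M ≈? 1#) not-all-roots
    in unit j , unit-≉0 j , uⱼᴹ≉1
    where
    not-all-roots : ¬ (∀ j → unit j ^ suc M ≈ 1#)
    not-all-roots all-roots = ℕ.<⇒≱ M<n (≡.subst (_≤ suc M) (List.length-tabulate unit)
      (monic-roots-bound (xⁿ-1-monic M)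
        (AllPairs.tabulate⁺ (λ i≢j uᵢ≈uⱼ → i≢j (unit-injective _ _ uᵢ≈uⱼ)))
        (All.tabulate⁺ λ j → trans (eval-xⁿ-1 (suc M) (unit j)) (x≈y⇒x∙y⁻¹≈ε (all-roots j)))))

  ∃-primitive-root : ∀ {r} → Prime r → r ∣ n → ∃ λ ζ → IsPrimitiveRoot ζ r
  ∃-primitive-root {r} r-prime (divides zero n≡0) with ≡.subst Fin n≡0 (unit-index 1# (0≉1 ∘ sym))
  ... | ()
  ∃-primitive-root {r} r-prime (divides M@(suc _) n≡M*r)
    with ∃-non-root-of-unity (s≤s z≤n) (≡.subst (M <_) (≡.sym n≡M*r) (ℕ.m<m*n M r 1<r))
    where 1<r = ℕ.nonTrivial⇒n>1 r {{prime⇒nonTrivial r-prime}}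
  ... | x , x≉0 , xᴹ≉1 = x ^ M , prime-order⇒primitive r-prime xᴹʳ≈1 xᴹ≉1
    where
    xᴹʳ≈1 : (x ^ M) ^ r ≈ 1#
    xᴹʳ≈1 = begin
      (x ^ M) ^ r    ≈⟨ ^-assocʳ x M r ⟩
      x ^ (M ℕ.* r)  ≡⟨ ≡.cong (x ^_) n≡M*r ⟨
      x ^ n          ≈⟨ fermat x≉0 ⟩
      1#             ∎

module NonVanishingDivisors {c ℓ} (F : Field c ℓ) {ζ} {m} (ζ-primitive : FieldProperties.IsPrimitiveRoot F ζ (suc m)) where
  open Field F hiding (zero)
  open Poly F
  open FieldProperties F
  open PolynomialArithmetic F
  open Evaluation F
  open Degree F
  open Roots F
  open Inflation F m
  open import Data.List using (List; []; _∷_; applyUpTo)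
  import Data.List.Properties as List
  open import Data.List.Relation.Unary.All using (All)
  import Data.List.Relation.Unary.All.Properties as All
  import Data.List.Relation.Unary.AllPairs.Properties as AllPairs
  open import Data.Nat.DivMod using (_/_; _%_; m≡m%n+[m/n]*n; m%n<n; m<n*o⇒m/o<n)
  open import Relation.Binary.Reasoning.Setoid setoid

  R : ℕ
  R = suc m

  NonVanishingDivisor : ℕ → ℕ → Set (c Level.⊔ ℓ)
  NonVanishingDivisor N k = ∃ λ f → MonicOfDegree f k × f ∣ₚ xⁿ-1 N × ¬ eval f 1# ≈ 0#

  ζ^u-is-root-of-unity : ∀ u → (ζ ^ u) ^ R ≈ 1#
  ζ^u-is-root-of-unity u = trans (^-assocʳ ζ u R) (^-multiple-≈1 R (proj₁ ζ-primitive) u)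

  ζ^u-root : ∀ N u → IsRoot (xⁿ-1 (R ℕ.* N)) (ζ ^ u)
  ζ^u-root N u = begin
    eval (xⁿ-1 (R ℕ.* N)) (ζ ^ u)   ≈⟨ eval-xⁿ-1 (R ℕ.* N) (ζ ^ u) ⟩
    (ζ ^ u) ^ (R ℕ.* N) - 1#        ≈⟨ +-congʳ (^-assocʳ (ζ ^ u) R N) ⟨
    ((ζ ^ u) ^ R) ^ N - 1#          ≈⟨ +-congʳ (trans (^-congˡ N (ζ^u-is-root-of-unity u)) (1^n≈1 N)) ⟩
    1# - 1#                         ≈⟨ -‿inverseʳ 1# ⟩
    0#                              ∎

  eval-inflate-ζ^u : ∀ f u → eval (inflate f) (ζ ^ u) ≈ eval f 1#
  eval-inflate-ζ^u f u = trans (eval-inflate f (ζ ^ u)) (eval-congʳ f (ζ^u-is-root-of-unity u))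

  powers : ℕ → List Carrier
  powers a = applyUpTo (λ u → ζ ^ suc u) a

  powers-distinct : ∀ {a} → a < R → Distinct (powers a)
  powers-distinct a<R = AllPairs.applyUpTo⁺₁ _ _ λ u<v v<a →
    primitive-^-distinct ζ-primitive (s≤s u<v) (ℕ.<-≤-trans (s≤s v<a) a<R)

  1∉powers : ∀ {a} → a < R → All (λ b → ¬ 1# ≈ b) (powers a)
  1∉powers a<R = All.applyUpTo⁺₁ _ _ λ u<a 1≈ζᵘ →
    proj₂ ζ-primitive _ (s≤s z≤n) (ℕ.<-≤-trans (s≤s u<a) a<R) (sym 1≈ζᵘ)

  1-nonVanishingDivisor : ∀ N → NonVanishingDivisor N 0
  1-nonVanishingDivisor N = 1# ∷ [] , 1-monic , (xⁿ-1 N , coeff-≈ (*ₚ-identityˡ (xⁿ-1 N))) ,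
    λ 1≈0 → 0≉1 (trans (sym 1≈0) (eval-const 1# 1#))

  inflate-and-extend : ∀ N k′ {a} → a < R → NonVanishingDivisor N k′ → NonVanishingDivisor (R ℕ.* N) (k′ ℕ.* R ℕ.+ a)
  inflate-and-extend N k′ {a} a<R (f , f-monic , f∣xᴺ-1 , f1≉0) = g , g-monic , g∣xᴿᴺ-1 , g1≉0
    where
    bs = powers a
    g = inflate f *ₚ (∏x- bs)

    g-monic : MonicOfDegree g (k′ ℕ.* R ℕ.+ a)
    g-monic = ≡.subst (MonicOfDegree g) (≡.cong (k′ ℕ.* R ℕ.+_) (List.length-applyUpTo _ a))
      (*ₚ-monic (inflate-monic f-monic) (∏x--monic bs))

    inflate-f-nonroot : ∀ u → ¬ IsRoot (inflate f) (ζ ^ u)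
    inflate-f-nonroot u = f1≉0 ∘ trans (sym (eval-inflate-ζ^u f u))

    g∣xᴿᴺ-1 : g ∣ₚ xⁿ-1 (R ℕ.* N)
    g∣xᴿᴺ-1 = ∏x--extends-divisor (inflate f) (xⁿ-1 (R ℕ.* N))
      (∣ₚ-respʳ-≋ (inflate f) (inflate-∣ₚ f (xⁿ-1 N) f∣xᴺ-1) (inflate-xⁿ-1 N)) (powers-distinct a<R)
      (All.applyUpTo⁺₂ _ a (ζ^u-root N ∘ suc)) (All.applyUpTo⁺₂ _ a (inflate-f-nonroot ∘ suc))

    g1≉0 : ¬ eval g 1# ≈ 0#
    g1≉0 = *-≉0 (inflate-f-nonroot 0) (eval-∏x--≉0 bs (1∉powers a<R))
      ∘ trans (sym (eval-*ₚ (inflate f) (∏x- bs) 1#))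

  nonVanishingDivisor : ∀ j k → k < R ℕ.^ j → NonVanishingDivisor (R ℕ.^ j) k
  nonVanishingDivisor zero    zero    _         = 1-nonVanishingDivisor 1
  nonVanishingDivisor zero    (suc k) (s≤s ())
  nonVanishingDivisor (suc j) k       k<Rʲ⁺¹ =
    ≡.subst (NonVanishingDivisor (R ℕ.^ suc j)) k≡[k/R]*R+k%R
      (inflate-and-extend (R ℕ.^ j) (k / R) (m%n<n k R)
        (nonVanishingDivisor j (k / R) (m<n*o⇒m/o<n (≡.subst (k <_) (ℕ.*-comm R (R ℕ.^ j)) k<Rʲ⁺¹))))
    where
    k≡[k/R]*R+k%R : k / R ℕ.* R ℕ.+ k % R ≡ k
    k≡[k/R]*R+k%R = ≡.trans (ℕ.+-comm (k / R ℕ.* R) (k % R)) (≡.sym (m≡m%n+[m/n]*n k R))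

empty-field-impossible : ∀ {c ℓ} (F : Field c ℓ) → ¬ HasCardinality F 0
empty-field-impossible F card with HasCardinality.surjective card (Field.0# F)
... | () , _

open import Data.Nat using (_^_)

lemma5p4 : ∀ {c ℓ : Level} (F : Field c ℓ) (q : ℕ) → IsPrimePower q → HasCardinality F q →
           (r : ℕ) → Prime r → r ∣ q ∸ 1 →
           (d : ℕ) → 1 ≤ d → (k : ℕ) → 1 ≤ k → k ≤ r ^ d ∸ 1 →
           ∃ λ f → Poly.HasDegree F f k × Poly._∣ₚ_ F f (Poly.xⁿ-1 F (r ^ d)) ×
             ¬ (Field._≈_ F (Poly.eval F f (Field.1# F)) (Field.0# F))
lemma5p4 F zero    _ card = ⊥-elim (empty-field-impossible F card)
lemma5p4 F (suc n) _ card zero ()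
lemma5p4 F (suc n) _ card (suc m) r-prime r∣n d _ k _ k≤rᵈ∸1
  with FiniteFields.∃-primitive-root F n card r-prime r∣n
... | ζ , ζ-primitive
  with NonVanishingDivisors.nonVanishingDivisor F ζ-primitive d k
         (ℕ.m≤pred[n]⇒suc[m]≤n {{ℕ.m^n≢0 (suc m) d}} k≤rᵈ∸1)
... | f , f-monic , f∣xʳᵈ-1 , f1≉0 = f , Degree.monic⇒hasDegree F f-monic , f∣xʳᵈ-1 , f1≉0
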